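{- Consider a partial packing of the three bins $A,B,C$ (all current loads at most $22$) such that $s(A)\in[4,6]$, with $s(B)$ and $s(C)$ arbitrary. Then there exists an online algorithm that, continuing from this partial packing, packs all remaining items of the input sequence into the three bins so that every bin has load at most $22$.
   Context: Scaled setting of Online Bin Stretching with three bins: items with sizes in $[0,16]$ arrive online one by one and each must be packed immediately and irrevocably into one of three bins $A,B,C$; it is guaranteed that the whole input sequence (items already packed together with all future items) can be packed offline into three bins of capacity $16$. A partial packing is an assignment of each item of some prefix of the input sequence (the items arrived so far) to one of the bins $A,B,C$. For a bin $X$, $s(X)$ denotes the total size of items currently assigned to $X$. The online algorithm must handle every possible continuation of the input satisfying the guarantee.
   Formalization: The item sizes, both of the items already packed and of all future items, are rational, so the online algorithm receives only rational item sizes. -}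

module Defs where

open import Data.Nat using (ℕ)
open import Data.Integer using (+_)
open import Data.Rational using (ℚ; _/_; _+_; _≤_; 0ℚ)
open import Data.List using (List; []; _∷_; _++_; map)
open import Data.Product using (_×_; _,_; proj₁; ∃)
open import Data.List.Relation.Unary.All using (All)
open import Relation.Binary.PropositionalEquality using (_≡_)

ℚ[_] : ℕ → ℚ
ℚ[ n ] = + n / 1

data Bin : Set where
  A B C : Bin

ValidItem : ℚ → Set
ValidItem x = (0ℚ ≤ x) × (x ≤ ℚ[ 16 ])

-- A (partial) packing: each item so far together with the bin it was put into.
-- Convention: the list is ordered newest item first.
Packing : Set
Packing = List (ℚ × Bin)

items : Packing → List ℚ
items = map proj₁

contrib : Bin → Bin → ℚ → ℚ
contrib A A x = x
contrib B B x = x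
contrib C C x = x
contrib _ _ _ = 0ℚ

load : Packing → Bin → ℚ
load [] X = 0ℚ
load ((x , Y) ∷ p) X = contrib X Y x + load p X

AllLoadsAtMost : ℚ → Packing → Set
AllLoadsAtMost c p = (X : Bin) → load p X ≤ c

OfflineFeasible : List ℚ → Set
OfflineFeasible xs = ∃ λ (p : Packing) → (items p ≡ xs) × AllLoadsAtMost ℚ[ 16 ] p

OnlineAlgorithm : Set
OnlineAlgorithm = Packing → ℚ → Bin

run : OnlineAlgorithm → Packing → List ℚ → Packing
run alg p [] = p
run alg p (x ∷ xs) = run alg ((x , alg p x) ∷ p) xs

-- Pack each item by First Fit into B, then C, and only then A.  While s(A) ≤ 6 an item
-- rejected by B still fits into A (it has size at most 16), and once it is placed there
-- s(A) + s(B) > 4 + 22 = 26.  From then on an item rejected by C as well would push the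
-- total size above 26 + 22 = 48 = 3 · 16, which no offline-feasible input allows; so A
-- receives at most one item and no bin is ever overfilled.
module Submission where

open import Defs
open import Data.Rational using (ℚ; _≤_; _<_; _+_; 0ℚ; _≤?_)
open import Data.Rational.Properties
open import Data.Rational.Solver using (module +-*-Solver)
open import Data.List using (List; []; _∷_; _++_; foldr)
open import Data.List.Relation.Unary.All as All using (All; []; _∷_)
open import Data.Product using (∃; _×_; _,_; proj₁; proj₂)
open import Data.Empty using (⊥-elim)
open import Relation.Nullary using (Dec; yes; no; ¬_)
open import Relation.Binary.PropositionalEquality

open +-*-Solver using (solve; _:+_; _:=_)

sumℚ : List ℚ → ℚ
sumℚ = foldr _+_ 0ℚ

sumℚ-++ : ∀ xs ys → sumℚ (xs ++ ys) ≡ sumℚ xs + sumℚ ys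
sumℚ-++ []       ys = sym (+-identityˡ (sumℚ ys))
sumℚ-++ (x ∷ xs) ys = begin
  x + sumℚ (xs ++ ys)        ≡⟨ cong (x +_) (sumℚ-++ xs ys) ⟩
  x + (sumℚ xs + sumℚ ys)    ≡⟨ sym (+-assoc x (sumℚ xs) (sumℚ ys)) ⟩
  (x + sumℚ xs) + sumℚ ys    ∎
  where open ≡-Reasoning

sumℚ-nonNeg : ∀ {xs} → All (0ℚ ≤_) xs → 0ℚ ≤ sumℚ xs
sumℚ-nonNeg []           = ≤-refl
sumℚ-nonNeg (x≥0 ∷ xs≥0) = +-mono-≤ x≥0 (sumℚ-nonNeg xs≥0)

totalLoad : Packing → ℚ
totalLoad p = (load p A + load p B) + load p C

totalLoad-∷ : ∀ z X p → totalLoad ((z , X) ∷ p) ≡ z + totalLoad p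
totalLoad-∷ z A p
  rewrite +-identityˡ (load p B) | +-identityˡ (load p C) =
  solve 4 (λ z a b c → ((z :+ a) :+ b) :+ c := z :+ ((a :+ b) :+ c))
    refl z (load p A) (load p B) (load p C)
totalLoad-∷ z B p
  rewrite +-identityˡ (load p A) | +-identityˡ (load p C) =
  solve 4 (λ z a b c → (a :+ (z :+ b)) :+ c := z :+ ((a :+ b) :+ c))
    refl z (load p A) (load p B) (load p C)
totalLoad-∷ z C p
  rewrite +-identityˡ (load p A) | +-identityˡ (load p B) =
  solve 4 (λ z a b c → (a :+ b) :+ (z :+ c) := z :+ ((a :+ b) :+ c))
    refl z (load p A) (load p B) (load p C)

sumℚ-items : ∀ p → sumℚ (items p) ≡ totalLoad p
sumℚ-items []            = refl
sumℚ-items ((z , X) ∷ p) = begin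
  z + sumℚ (items p)       ≡⟨ cong (z +_) (sumℚ-items p) ⟩
  z + totalLoad p          ≡⟨ sym (totalLoad-∷ z X p) ⟩
  totalLoad ((z , X) ∷ p)  ∎
  where open ≡-Reasoning

totalLoad-atMost : ∀ {c} p → AllLoadsAtMost c p → totalLoad p ≤ (c + c) + c
totalLoad-atMost p bound = +-mono-≤ (+-mono-≤ (bound A) (bound B)) (bound C)

offlineFeasible⇒totalSize≤48 : ∀ p xs → OfflineFeasible (items p ++ xs)
  → totalLoad p + sumℚ xs ≤ ℚ[ 48 ]
offlineFeasible⇒totalSize≤48 p xs (q , items-q , bound) = begin
  totalLoad p + sumℚ xs        ≡⟨ cong (_+ sumℚ xs) (sumℚ-items p) ⟨
  sumℚ (items p) + sumℚ xs     ≡⟨ sumℚ-++ (items p) xs ⟨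
  sumℚ (items p ++ xs)         ≡⟨ cong sumℚ items-q ⟨
  sumℚ (items q)               ≡⟨ sumℚ-items q ⟩
  totalLoad q                  ≤⟨ totalLoad-atMost q bound ⟩
  ℚ[ 48 ]                      ∎
  where open ≤-Reasoning

0+-≤ : ∀ {q c} → q ≤ c → 0ℚ + q ≤ c
0+-≤ {q} = ≤-trans (≤-reflexive (+-identityˡ q))

insert-atMost : ∀ {c p z} X → AllLoadsAtMost c p → z + load p X ≤ c
  → AllLoadsAtMost c ((z , X) ∷ p)
insert-atMost A bound fits A = fits
insert-atMost A bound fits B = 0+-≤ (bound B)
insert-atMost A bound fits C = 0+-≤ (bound C)
insert-atMost B bound fits A = 0+-≤ (bound A)
insert-atMost B bound fits B = fits
insert-atMost B bound fits C = 0+-≤ (bound C)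
insert-atMost C bound fits A = 0+-≤ (bound A)
insert-atMost C bound fits B = 0+-≤ (bound B)
insert-atMost C bound fits C = fits

data Phase (p : Packing) : Set where
  light : ℚ[ 4 ] ≤ load p A → load p A ≤ ℚ[ 6 ] → Phase p
  heavy : ℚ[ 26 ] < load p A + load p B → Phase p

phase-transport : ∀ {p q} → load q A ≡ load p A → load p B ≤ load q B → Phase p → Phase q
phase-transport sameA _ (light 4≤a a≤6) =
  light (≤-trans 4≤a (≤-reflexive (sym sameA))) (≤-trans (≤-reflexive sameA) a≤6)
phase-transport sameA growsB (heavy 26<a+b) =
  heavy (<-≤-trans 26<a+b (+-mono-≤ (≤-reflexive (sym sameA)) growsB))

phase-insertB : ∀ {p z} → 0ℚ ≤ z → Phase p → Phase ((z , B) ∷ p)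
phase-insertB {p} z≥0 = phase-transport (+-identityˡ (load p A))
  (≤-trans (≤-reflexive (sym (+-identityˡ (load p B)))) (+-monoˡ-≤ (load p B) z≥0))

phase-insertC : ∀ {p z} → Phase p → Phase ((z , C) ∷ p)
phase-insertC {p} = phase-transport (+-identityˡ (load p A))
  (≤-reflexive (sym (+-identityˡ (load p B))))

fits? : (p : Packing) (X : Bin) (z : ℚ) → Dec (z + load p X ≤ ℚ[ 22 ])
fits? p X z = z + load p X ≤? ℚ[ 22 ]

firstFitBCA : OnlineAlgorithm
firstFitBCA p z with fits? p B z | fits? p C z
... | yes _ | _     = B
... | no _  | yes _ = C
... | no _  | no _  = A

26+22<total : ∀ a b c z → ℚ[ 26 ] < a + b → ℚ[ 22 ] < z + c → ℚ[ 48 ] < ((a + b) + c) + z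
26+22<total a b c z 26<a+b 22<z+c = <-≤-trans (+-mono-< 26<a+b 22<z+c) (≤-reflexive
  (solve 4 (λ a b c z → (a :+ b) :+ (z :+ c) := ((a :+ b) :+ c) :+ z) refl a b c z))

4+22<A+B : ∀ a b z → ℚ[ 4 ] ≤ a → ℚ[ 22 ] < z + b → ℚ[ 26 ] < (z + a) + (0ℚ + b)
4+22<A+B a b z 4≤a 22<z+b rewrite +-identityˡ b = <-≤-trans (+-mono-≤-< 4≤a 22<z+b) (≤-reflexive
  (solve 3 (λ a b z → a :+ (z :+ b) := (z :+ a) :+ b) refl a b z))

insertA-safe : ∀ {p z} → Phase p → AllLoadsAtMost ℚ[ 22 ] p
  → z ≤ ℚ[ 16 ] → totalLoad p + z ≤ ℚ[ 48 ]
  → ¬ (z + load p B ≤ ℚ[ 22 ]) → ¬ (z + load p C ≤ ℚ[ 22 ])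
  → Phase ((z , A) ∷ p) × AllLoadsAtMost ℚ[ 22 ] ((z , A) ∷ p)
insertA-safe {p} {z} (light 4≤a a≤6) bound z≤16 _ ¬fitsB _ =
  heavy (4+22<A+B (load p A) (load p B) z 4≤a (≰⇒> ¬fitsB)) ,
  insert-atMost {p = p} A bound (+-mono-≤ z≤16 a≤6)
insertA-safe {p} {z} (heavy 26<a+b) _ _ budget _ ¬fitsC =
  ⊥-elim (<-irrefl refl (<-≤-trans overfull budget))
  where
  overfull : ℚ[ 48 ] < totalLoad p + z
  overfull = 26+22<total (load p A) (load p B) (load p C) z 26<a+b (≰⇒> ¬fitsC)

firstFitBCA-step : ∀ {p z} → Phase p → AllLoadsAtMost ℚ[ 22 ] p
  → ValidItem z → totalLoad p + z ≤ ℚ[ 48 ]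
  → Phase ((z , firstFitBCA p z) ∷ p) × AllLoadsAtMost ℚ[ 22 ] ((z , firstFitBCA p z) ∷ p)
firstFitBCA-step {p} {z} phase bound (z≥0 , z≤16) budget with fits? p B z | fits? p C z
... | yes fitsB | _         = phase-insertB z≥0 phase , insert-atMost {p = p} B bound fitsB
... | no _      | yes fitsC = phase-insertC phase , insert-atMost {p = p} C bound fitsC
... | no ¬fitsB | no ¬fitsC = insertA-safe phase bound z≤16 budget ¬fitsB ¬fitsC

firstFitBCA-run : ∀ xs p → Phase p → AllLoadsAtMost ℚ[ 22 ] p → All ValidItem xs
  → totalLoad p + sumℚ xs ≤ ℚ[ 48 ] → AllLoadsAtMost ℚ[ 22 ] (run firstFitBCA p xs)
firstFitBCA-run []       p phase bound []                   budget = bound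
firstFitBCA-run (z ∷ zs) p phase bound (z-valid ∷ zs-valid) budget =
  firstFitBCA-run zs p′ (proj₁ next) (proj₂ next) zs-valid budget′
  where
  p′ : Packing
  p′ = (z , firstFitBCA p z) ∷ p
  budgetNow : totalLoad p + z ≤ ℚ[ 48 ]
  budgetNow = ≤-trans (+-monoʳ-≤ (totalLoad p) z≤z+rest) budget
    where
    z≤z+rest : z ≤ z + sumℚ zs
    z≤z+rest = ≤-trans (≤-reflexive (sym (+-identityʳ z)))
                       (+-monoʳ-≤ z (sumℚ-nonNeg (All.map proj₁ zs-valid)))
  next : Phase p′ × AllLoadsAtMost ℚ[ 22 ] p′
  next = firstFitBCA-step phase bound z-valid budgetNow
  budget′ : totalLoad p′ + sumℚ zs ≤ ℚ[ 48 ]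
  budget′ = ≤-trans (≤-reflexive (begin
    totalLoad p′ + sumℚ zs         ≡⟨ cong (_+ sumℚ zs) (totalLoad-∷ z (firstFitBCA p z) p) ⟩
    (z + totalLoad p) + sumℚ zs    ≡⟨ cong (_+ sumℚ zs) (+-comm z (totalLoad p)) ⟩
    (totalLoad p + z) + sumℚ zs    ≡⟨ +-assoc (totalLoad p) z (sumℚ zs) ⟩
    totalLoad p + (z + sumℚ zs)    ∎)) budget
    where open ≡-Reasoning

mainTheorem5 : (P : Packing)
    → All ValidItem (items P)
    → AllLoadsAtMost ℚ[ 22 ] P
    → ℚ[ 4 ] ≤ load P A
    → load P A ≤ ℚ[ 6 ]
    → ∃ λ (alg : OnlineAlgorithm) →
        (xs : List ℚ)
        → All ValidItem xs
        → OfflineFeasible (items P ++ xs)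
        → AllLoadsAtMost ℚ[ 22 ] (run alg P xs)
-- The sizes of the items already packed matter only through the loads of the bins.
mainTheorem5 P _ bound 4≤a a≤6 = firstFitBCA , λ xs xs-valid feasible →
  firstFitBCA-run xs P (light 4≤a a≤6) bound xs-valid
    (offlineFeasible⇒totalSize≤48 P xs feasible)
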